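{- Let $\ell\geq1$, $h\geq1$, $1\leq d\leq h$, and let $\mu=(h,1,1,\dotsc,1)$ be the hook with $\ell+1$ parts (so $\mu_0=h$ and $\mu_1=\cdots=\mu_\ell=1$). Then \[ B_{\mu,d}(x,t)=x+x^{\ell+1}\,\frac{\bigl(1+t(x+x^2+\cdots+x^\ell)\bigr)^d-1}{x+x^2+\cdots+x^\ell} = x+\sum_{k=1}^{d}t^k\binom{d}{k}x^{\ell+1}(x+x^2+\cdots+x^\ell)^{k-1}. \] In particular, for $\ell=1$ and $d=h$, one has $\mathbf{F}_{\mu,d}(x,t)=\dfrac{1}{1-x(1+xt)^d}$.
   Context: For a partition $\mu=(\mu_0\geq\cdots\geq\mu_\ell\geq1)$: an anchor word of length $n$ is a word $a_1\cdots a_n$ over $\{1,\dotsc,d,\infty\}$ such that $a_i\neq\infty$ implies $a_{i+k}\geq a_i+\mu_k$ for $k=1,\dotsc,\ell$ ($\infty$ larger than every integer) and $a_{n-\ell+1}=\cdots=a_n=\infty$. $\mathrm{bigtiles}(w)$ is the number of non-$\infty$ letters and $\mathrm{width}(w)$ the length. A fault-free anchor word is either $(\infty)$ or a word starting with an integer, ending with $\ell$ consecutive $\infty$'s, with that final block being the only occurrence of $\ell$ consecutive $\infty$'s. $B_{\mu,d}(x,t)=\sum x^{\mathrm{width}(w)}t^{\mathrm{bigtiles}(w)}$ over fault-free anchor words, and $\mathbf{F}_{\mu,d}(x,t)=\sum_{n\geq0}\sum_{w}t^{\mathrm{bigtiles}(w)}x^n$ over all anchor words $w$ of length $n$. -}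

module Defs where

open import Data.Nat using (ℕ; zero; suc; _+_; _*_; _∸_; _≤_; _<_; _≤?_; _<?_)
open import Data.Nat.Properties using (≤-refl)
open import Data.Nat.Combinatorics using (_C_)
open import Data.Fin using (Fin; toℕ)
open import Data.Fin.Properties using (all?)
import Data.Fin.Properties as FinP
open import Data.Maybe using (Maybe; just; nothing)
import Data.Maybe.Properties as MaybeP
open import Data.List using (List; []; _∷_; length; filter; map; concatMap; allFin)
import Data.List.Properties as ListP
open import Data.Vec using (Vec; lookup; replicate; _∷_)
open import Data.Product using (_×_; _,_; ∃)
open import Data.Sum using (_⊎_)
open import Data.Unit using (⊤; tt)
open import Data.Empty using (⊥)
open import Relation.Nullary using (Dec; yes; no)
open import Relation.Nullary.Decidable using (_×-dec_; _⊎-dec_; _→-dec_)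
open import Relation.Binary.PropositionalEquality using (_≡_; refl)

-- Letters and words
-- A letter over {1,…,d,∞}: nothing = ∞, just j = the integer toℕ j + 1.

Letter : ℕ → Set
Letter d = Maybe (Fin d)

val : ∀ {d} → Fin d → ℕ
val j = suc (toℕ j)

Word : ℕ → Set
Word d = List (Letter d)

-- position m of a word (0-based); positions outside the word read as ∞
-- (only used for constraints a_{i+k} with i+k beyond the word, which the
-- paper does not impose)
at : ∀ {d} → Word d → ℕ → Letter d
at []      _       = nothing
at (x ∷ w) zero    = x
at (x ∷ w) (suc m) = at w m

IsInf : ∀ {d} → Letter d → Set
IsInf nothing  = ⊤
IsInf (just _) = ⊥

-- "if a ≠ ∞ then b ≥ a + m" (∞ larger than every integer)
AnchorCond : ∀ {d} → Letter d → Letter d → ℕ → Set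
AnchorCond nothing  _        _ = ⊤
AnchorCond (just a) nothing  _ = ⊤
AnchorCond (just a) (just b) m = val a + m ≤ val b

bigtiles : ∀ {d} → Word d → ℕ
bigtiles []             = 0
bigtiles (nothing ∷ w)  = bigtiles w
bigtiles (just _ ∷ w)   = suc (bigtiles w)

Shape : ℕ → Set
Shape ℓ = Vec ℕ (suc ℓ)

hook : (h ℓ : ℕ) → Shape ℓ
hook h ℓ = h ∷ replicate ℓ 1

-- Anchor words (positions 0-based: a_{i+1} is at w i)

IsAnchor : ∀ {ℓ d} → Shape ℓ → Word d → Set
IsAnchor {ℓ} μ w =
  (∀ (i : Fin (length w)) (k : Fin ℓ) →
     AnchorCond (at w (toℕ i)) (at w (toℕ i + suc (toℕ k))) (lookup μ (Fin.suc k)))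
  × (∀ (i : Fin (length w)) → length w ≤ toℕ i + ℓ → IsInf (at w (toℕ i)))
  where import Data.Fin as Fin

StartsWithInteger : ∀ {d} → Word d → Set
StartsWithInteger (just _ ∷ _) = ⊤
StartsWithInteger _            = ⊥

InfBlockAt : ∀ {d} → ℕ → Word d → ℕ → Set
InfBlockAt ℓ w i = (i + ℓ ≤ length w) × (∀ (j : Fin ℓ) → IsInf (at w (i + toℕ j)))

IsFaultFree : ∀ {ℓ d} → Shape ℓ → Word d → Set
IsFaultFree {ℓ} μ w =
  IsAnchor μ w ×
  ( (w ≡ nothing ∷ [])
  ⊎ ( StartsWithInteger w
    × (ℓ < length w × InfBlockAt ℓ w (length w ∸ ℓ))
    × (∀ (i : Fin (length w)) → InfBlockAt ℓ w (toℕ i) → toℕ i + ℓ ≡ length w)))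

isInf? : ∀ {d} (a : Letter d) → Dec (IsInf a)
isInf? nothing  = yes tt
isInf? (just _) = no (λ ())

anchorCond? : ∀ {d} (a b : Letter d) (m : ℕ) → Dec (AnchorCond a b m)
anchorCond? nothing  _        _ = yes tt
anchorCond? (just a) nothing  _ = yes tt
anchorCond? (just a) (just b) m = val a + m ≤? val b

isAnchor? : ∀ {ℓ d} (μ : Shape ℓ) (w : Word d) → Dec (IsAnchor μ w)
isAnchor? {ℓ} μ w =
  all? (λ i → all? (λ k → anchorCond? _ _ _))
  ×-dec all? (λ i → (length w ≤? toℕ i + ℓ) →-dec isInf? _)

startsWithInteger? : ∀ {d} (w : Word d) → Dec (StartsWithInteger w)
startsWithInteger? []           = no (λ ())
startsWithInteger? (nothing ∷ _) = no (λ ())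
startsWithInteger? (just _ ∷ _) = yes tt

infBlockAt? : ∀ {d} ℓ (w : Word d) i → Dec (InfBlockAt ℓ w i)
infBlockAt? ℓ w i = (i + ℓ ≤? length w) ×-dec all? (λ j → isInf? _)

isFaultFree? : ∀ {ℓ d} (μ : Shape ℓ) (w : Word d) → Dec (IsFaultFree μ w)
isFaultFree? {ℓ} {d} μ w =
  isAnchor? μ w ×-dec
  ( ListP.≡-dec (MaybeP.≡-dec FinP._≟_) w (nothing ∷ [])
  ⊎-dec ( startsWithInteger? w
        ×-dec ((ℓ <? length w) ×-dec infBlockAt? ℓ w (length w ∸ ℓ))
        ×-dec all? (λ i → infBlockAt? ℓ w (toℕ i) →-dec (toℕ i + ℓ ≟ length w))))
  where open import Data.Nat using (_≟_)

letters : (d : ℕ) → List (Letter d)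
letters d = nothing ∷ map just (allFin d)

words : (d n : ℕ) → List (Word d)
words d zero    = [] ∷ []
words d (suc n) = concatMap (λ a → map (a ∷_) (words d n)) (letters d)

-- Formal power series in x, t with ℕ coefficients:
-- p i j = coefficient of x^i t^j

Series : Set
Series = ℕ → ℕ → ℕ

sumTo : ℕ → (ℕ → ℕ) → ℕ
sumTo zero    f = f 0
sumTo (suc n) f = sumTo n f + f (suc n)

cst : ℕ → Series
cst c zero zero = c
cst c _    _    = 0

𝟙 : Series
𝟙 = cst 1

X : Series
X (suc zero) zero = 1
X _          _    = 0

T : Series
T zero (suc zero) = 1
T _    _          = 0

infixl 6 _⊕_
infixl 7 _⊗_
infixr 8 _^^_

_⊕_ : Series → Series → Series
(p ⊕ q) i j = p i j + q i j

_⊗_ : Series → Series → Series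
(p ⊗ q) i j = sumTo i (λ a → sumTo j (λ c → p a c * q (i ∸ a) (j ∸ c)))

_^^_ : Series → ℕ → Series
p ^^ zero  = 𝟙
p ^^ suc k = p ⊗ (p ^^ k)

ΣS : ℕ → (ℕ → Series) → Series
ΣS zero    f = cst 0
ΣS (suc n) f = ΣS n f ⊕ f (suc n)

count : ∀ {A : Set} {P : A → Set} → ((a : A) → Dec (P a)) → List A → ℕ
count P? xs = length (filter P? xs)

B : ∀ {ℓ} → Shape ℓ → (d : ℕ) → Series
B μ d n b = count (λ w → isFaultFree? μ w ×-dec (bigtiles w ≟ b)) (words d n)
  where open import Data.Nat using (_≟_)

F : ∀ {ℓ} → Shape ℓ → (d : ℕ) → Series
F μ d n b = count (λ w → isAnchor? μ w ×-dec (bigtiles w ≟ b)) (words d n)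
  where open import Data.Nat using (_≟_)

{-# OPTIONS --safe #-}
-- For the hook μ = (h,1,…,1) the anchor condition only says that an integer letter is smaller than
-- every integer among the next ℓ letters.  Read letter by letter, fault-free words (and, for ℓ = 1,
-- all anchor words) are recognised by automata whose state records the last integer letter v.  The
-- generating functions K v of these states satisfy the triangular system
--   K v = a + Y · Σ_{v < m ≤ d} K m,
-- which, solved downwards from v = d, gives K 0 = a (1 + Y)^d and Σ_{0 < m ≤ d} K m = a ((1 + Y)^d − 1) / Y.
-- For fault-free words a = x^ℓ and Y = t (x + ⋯ + x^ℓ); for anchor words with ℓ = 1, a = x F and Y = x t.
module Submission where

open import Defs
open import Data.Nat using (ℕ; suc; _≤_; _∸_)
open import Data.Nat.Combinatorics using (_C_)
open import Data.Product using (_×_)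
open import Relation.Binary.PropositionalEquality using (_≡_)

open import Algebra.Bundles using (CommutativeSemiring)
open import Algebra.Core using (Op₂)
open import Algebra.Structures using (IsCommutativeSemiring)
open import Algebra.Structures.Biased using (isCommutativeSemiringˡ; isCommutativeMonoidˡ)
open import Data.Bool using (Bool; true; false; if_then_else_; _∧_) renaming (T to IsTrue)
import Data.Bool.Properties as BoolP
open import Data.Empty using (⊥-elim)
open import Data.Fin as Fin using (Fin; toℕ)
import Data.Fin.Properties as FinP
open import Data.List as List using (List; []; _∷_)
import Data.List.Properties as ListP
import Data.List.Relation.Unary.All as All
open import Data.Maybe using (just; nothing)
open import Data.Nat using (zero; z≤n; s≤s; s≤s⁻¹; _<_; _<ᵇ_; _≟_)
import Data.Nat as ℕ
import Data.Nat.Properties as ℕₚ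
open import Data.Nat.Combinatorics using (nCk+nC[k+1]≡[n+1]C[k+1]; k>n⇒nCk≡0)
open import Data.Product as Prod using (_,_; proj₁; proj₂)
open import Data.Sum using (inj₁; inj₂)
open import Data.Unit using (⊤)
open import Data.Vec using (lookup)
import Data.Vec.Properties as VecP
open import Function using (_∘_; id)
open import Function.Bundles using (_⇔_; mk⇔; Equivalence)
import Function.Properties.Equivalence as ⇔
open import Level using (Level; 0ℓ)
open import Relation.Binary.Structures using (IsEquivalence)
import Relation.Binary.PropositionalEquality as ≡
open import Relation.Nullary using (¬_; does; contradiction)
open import Relation.Nullary.Decidable using (_×-dec_; T?)
open import Relation.Unary using (Pred; Decidable; _≐_)

import Algebra.Properties.Monoid.Sum ℕₚ.+-0-monoid as ℕΣ

open Equivalence using (to; from)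

module _ {c e : Level} (S : CommutativeSemiring c e) where

  open CommutativeSemiring S
  open import Relation.Binary.Reasoning.Setoid setoid

  isCommutativeSemiring-subst : ∀ {_⊛_ : Op₂ Carrier} {0′ 1′} → (∀ x y → (x ⊛ y) ≈ x * y) →
    0′ ≈ 0# → 1′ ≈ 1# → IsCommutativeSemiring _≈_ _+_ _⊛_ 0′ 1′
  isCommutativeSemiring-subst {_⊛_} {0′} {1′} ⊛≈* 0′≈0 1′≈1 = isCommutativeSemiringˡ record
    { +-isCommutativeMonoid = isCommutativeMonoidˡ record
      { isSemigroup = +-isSemigroup
      ; identityˡ   = λ x → trans (+-congʳ 0′≈0) (+-identityˡ x)
      ; comm        = +-comm }
    ; *-isCommutativeMonoid = isCommutativeMonoidˡ record
      { isSemigroup = record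
        { isMagma = record { isEquivalence = isEquivalence ; ∙-cong = ⊛-cong }
        ; assoc   = λ x y z → begin
            (x ⊛ y) ⊛ z ≈⟨ ⊛≈* (x ⊛ y) z ⟩
            (x ⊛ y) * z ≈⟨ *-congʳ (⊛≈* x y) ⟩
            (x * y) * z ≈⟨ *-assoc x y z ⟩
            x * (y * z) ≈⟨ *-congˡ (⊛≈* y z) ⟨
            x * (y ⊛ z) ≈⟨ ⊛≈* x (y ⊛ z) ⟨
            x ⊛ (y ⊛ z) ∎ }
      ; identityˡ = λ x → trans (⊛≈* 1′ x) (trans (*-congʳ 1′≈1) (*-identityˡ x))
      ; comm      = λ x y → trans (⊛≈* x y) (trans (*-comm x y) (sym (⊛≈* y x))) }
    ; distribʳ = λ x y z → begin
        (y + z) ⊛ x   ≈⟨ ⊛≈* (y + z) x ⟩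
        (y + z) * x   ≈⟨ distribʳ x y z ⟩
        y * x + z * x ≈⟨ +-cong (⊛≈* y x) (⊛≈* z x) ⟨
        y ⊛ x + z ⊛ x ∎
    ; zeroˡ = λ x → begin
        0′ ⊛ x ≈⟨ ⊛≈* 0′ x ⟩
        0′ * x ≈⟨ *-congʳ 0′≈0 ⟩
        0# * x ≈⟨ zeroˡ x ⟩
        0#     ≈⟨ 0′≈0 ⟨
        0′     ∎ }
    where
    ⊛-cong : ∀ {x y u v} → x ≈ y → u ≈ v → (x ⊛ u) ≈ (y ⊛ v)
    ⊛-cong {x} {y} {u} {v} x≈y u≈v = trans (⊛≈* x u) (trans (*-cong x≈y u≈v) (sym (⊛≈* y v)))

module PowerSeries {c e : Level} (R : CommutativeSemiring c e) where

  open CommutativeSemiring R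
  open import Relation.Binary.Reasoning.Setoid setoid

  PowerSeries : Set c
  PowerSeries = ℕ → Carrier

  infix 4 _≋_
  record _≋_ (p q : PowerSeries) : Set e where
    constructor coeffwise
    field coeff : ∀ n → p n ≈ q n
  open _≋_ public

  ∑≤ : ℕ → (ℕ → Carrier) → Carrier
  ∑≤ zero    f = f 0
  ∑≤ (suc n) f = ∑≤ n f + f (suc n)

  ∑≤-cong : ∀ n {f g : ℕ → Carrier} → (∀ a → a ≤ n → f a ≈ g a) → ∑≤ n f ≈ ∑≤ n g
  ∑≤-cong zero    f≈g = f≈g 0 z≤n
  ∑≤-cong (suc n) f≈g =
    +-cong (∑≤-cong n (λ a a≤n → f≈g a (ℕₚ.m≤n⇒m≤1+n a≤n))) (f≈g (suc n) ℕₚ.≤-refl)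

  ∑≤-suc-head : ∀ n f → ∑≤ (suc n) f ≈ f 0 + ∑≤ n (f ∘ suc)
  ∑≤-suc-head zero    f = refl
  ∑≤-suc-head (suc n) f = trans (+-congʳ (∑≤-suc-head n f)) (+-assoc _ _ _)

  ∑≤-distrib-+ : ∀ n f g → ∑≤ n (λ a → f a + g a) ≈ ∑≤ n f + ∑≤ n g
  ∑≤-distrib-+ zero    f g = refl
  ∑≤-distrib-+ (suc n) f g = trans (+-congʳ (∑≤-distrib-+ n f g)) (interchange _ _ _ _)
    where open import Algebra.Properties.CommutativeSemigroup +-commutativeSemigroup using (interchange)

  *-distribˡ-∑≤ : ∀ n x f → x * ∑≤ n f ≈ ∑≤ n (λ a → x * f a)
  *-distribˡ-∑≤ zero    x f = refl
  *-distribˡ-∑≤ (suc n) x f = trans (distribˡ x _ _) (+-congʳ (*-distribˡ-∑≤ n x f))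

  ∑≤-zero : ∀ n f → (∀ a → f a ≈ 0#) → ∑≤ n f ≈ 0#
  ∑≤-zero zero    f f≈0 = f≈0 0
  ∑≤-zero (suc n) f f≈0 = trans (+-cong (∑≤-zero n f f≈0) (f≈0 (suc n))) (+-identityˡ 0#)

  ∑≤-reverse : ∀ n f → ∑≤ n f ≈ ∑≤ n (λ a → f (n ∸ a))
  ∑≤-reverse zero    f = refl
  ∑≤-reverse (suc n) f = begin
    ∑≤ n f + f (suc n)                 ≈⟨ +-congʳ (∑≤-reverse n f) ⟩
    ∑≤ n (λ a → f (n ∸ a)) + f (suc n) ≈⟨ +-comm _ _ ⟩
    f (suc n) + ∑≤ n (λ a → f (n ∸ a)) ≈⟨ ∑≤-suc-head n (λ a → f (suc n ∸ a)) ⟨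
    ∑≤ (suc n) (λ a → f (suc n ∸ a))   ∎

  const : Carrier → PowerSeries
  const x zero    = x
  const x (suc _) = 0#

  𝟘 𝟏 𝕩 : PowerSeries
  𝟘 _ = 0#
  𝟏 = const 1#
  𝕩 1 = 1#
  𝕩 _ = 0#

  tail : PowerSeries → PowerSeries
  tail p n = p (suc n)

  infixl 6 _⊞_
  infixl 7 _⊠_ _·_

  _⊞_ : Op₂ PowerSeries
  (p ⊞ q) n = p n + q n

  _⊠_ : Op₂ PowerSeries
  (p ⊠ q) n = ∑≤ n (λ a → p a * q (n ∸ a))

  _·_ : Carrier → PowerSeries → PowerSeries
  (x · p) n = x * p n

  ⊠-suc : ∀ p q n → (p ⊠ q) (suc n) ≈ p 0 * q (suc n) + (tail p ⊠ q) n
  ⊠-suc p q n = ∑≤-suc-head n (λ a → p a * q (suc n ∸ a))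

  ⊠-cong : ∀ {p p′ q q′} → p ≋ p′ → q ≋ q′ → p ⊠ q ≋ p′ ⊠ q′
  ⊠-cong p≋p′ q≋q′ = coeffwise λ n →
    ∑≤-cong n λ a _ → *-cong (coeff p≋p′ a) (coeff q≋q′ (n ∸ a))

  ⊠-congʳ : ∀ {p p′} r → p ≋ p′ → p ⊠ r ≋ p′ ⊠ r
  ⊠-congʳ r p≋p′ = coeffwise λ n → ∑≤-cong n λ a _ → *-congʳ (coeff p≋p′ a)

  ⊠-comm : ∀ p q → p ⊠ q ≋ q ⊠ p
  ⊠-comm p q = coeffwise λ n → begin
    ∑≤ n (λ a → p a * q (n ∸ a))             ≈⟨ ∑≤-reverse n _ ⟩
    ∑≤ n (λ a → p (n ∸ a) * q (n ∸ (n ∸ a))) ≈⟨ ∑≤-cong n (λ a a≤n →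
      trans (*-comm _ _) (reflexive (≡.cong (λ b → q b * p (n ∸ a)) (ℕₚ.m∸[m∸n]≡n a≤n)))) ⟩
    ∑≤ n (λ a → q a * p (n ∸ a))             ∎

  ⊠-distribʳ : ∀ p q r → (p ⊞ q) ⊠ r ≋ p ⊠ r ⊞ q ⊠ r
  ⊠-distribʳ p q r = coeffwise λ n → trans (∑≤-cong n λ a _ → distribʳ _ _ _) (∑≤-distrib-+ n _ _)

  ·-⊠-assoc : ∀ x p q → (x · p) ⊠ q ≋ x · (p ⊠ q)
  ·-⊠-assoc x p q = coeffwise λ n → trans (∑≤-cong n λ a _ → *-assoc _ _ _) (sym (*-distribˡ-∑≤ n x _))

  ⊠-assoc : ∀ p q r → (p ⊠ q) ⊠ r ≋ p ⊠ (q ⊠ r)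
  ⊠-assoc p q r = coeffwise λ n → assoc n p q r
    where
    assoc : ∀ n p q r → ((p ⊠ q) ⊠ r) n ≈ (p ⊠ (q ⊠ r)) n
    assoc zero    p q r = *-assoc _ _ _
    assoc (suc n) p q r = begin
      ((p ⊠ q) ⊠ r) (suc n)
        ≈⟨ ⊠-suc (p ⊠ q) r n ⟩
      p 0 * q 0 * r (suc n) + (tail (p ⊠ q) ⊠ r) n
        ≈⟨ +-cong (*-assoc _ _ _) (coeff (⊠-congʳ r (coeffwise (⊠-suc p q))) n) ⟩
      p 0 * (q 0 * r (suc n)) + ((p 0 · tail q ⊞ tail p ⊠ q) ⊠ r) n
        ≈⟨ +-congˡ (coeff (⊠-distribʳ _ _ r) n) ⟩
      p 0 * (q 0 * r (suc n)) + (((p 0 · tail q) ⊠ r) n + ((tail p ⊠ q) ⊠ r) n)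
        ≈⟨ +-congˡ (+-cong (coeff (·-⊠-assoc (p 0) (tail q) r) n) (assoc n (tail p) q r)) ⟩
      p 0 * (q 0 * r (suc n)) + (p 0 * (tail q ⊠ r) n + (tail p ⊠ (q ⊠ r)) n)
        ≈⟨ +-assoc _ _ _ ⟨
      p 0 * (q 0 * r (suc n)) + p 0 * (tail q ⊠ r) n + (tail p ⊠ (q ⊠ r)) n
        ≈⟨ +-congʳ (distribˡ _ _ _) ⟨
      p 0 * (q 0 * r (suc n) + (tail q ⊠ r) n) + (tail p ⊠ (q ⊠ r)) n
        ≈⟨ +-congʳ (*-congˡ (⊠-suc q r n)) ⟨
      p 0 * (q ⊠ r) (suc n) + (tail p ⊠ (q ⊠ r)) n
        ≈⟨ ⊠-suc p (q ⊠ r) n ⟨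
      (p ⊠ (q ⊠ r)) (suc n) ∎

  const-⊠ : ∀ x p → const x ⊠ p ≋ x · p
  const-⊠ x p = coeffwise λ where
    zero    → refl
    (suc n) → begin
      (const x ⊠ p) (suc n)                  ≈⟨ ⊠-suc (const x) p n ⟩
      x * p (suc n) + (tail (const x) ⊠ p) n ≈⟨ +-congˡ (∑≤-zero n _ λ _ → zeroˡ _) ⟩
      x * p (suc n) + 0#                     ≈⟨ +-identityʳ _ ⟩
      x * p (suc n)                          ∎

  ⊠-identityˡ : ∀ p → 𝟏 ⊠ p ≋ p
  ⊠-identityˡ p = coeffwise λ n → trans (coeff (const-⊠ 1# p) n) (*-identityˡ _)

  𝕩-⊠-zero : ∀ p → (𝕩 ⊠ p) 0 ≈ 0#
  𝕩-⊠-zero p = zeroˡ _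

  𝕩-⊠-suc : ∀ p n → (𝕩 ⊠ p) (suc n) ≈ p n
  𝕩-⊠-suc p n = begin
    (𝕩 ⊠ p) (suc n)                 ≈⟨ ⊠-suc 𝕩 p n ⟩
    0# * p (suc n) + (tail 𝕩 ⊠ p) n ≈⟨ +-cong (zeroˡ _) (coeff (⊠-congʳ p tail𝕩≋𝟏) n) ⟩
    0# + (𝟏 ⊠ p) n                  ≈⟨ +-identityˡ _ ⟩
    (𝟏 ⊠ p) n                       ≈⟨ coeff (⊠-identityˡ p) n ⟩
    p n                             ∎
    where
    tail𝕩≋𝟏 : tail 𝕩 ≋ 𝟏
    tail𝕩≋𝟏 = coeffwise λ { zero → refl ; (suc _) → refl }

  ⊞-⊠-isCommutativeSemiring : IsCommutativeSemiring _≋_ _⊞_ _⊠_ 𝟘 𝟏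
  ⊞-⊠-isCommutativeSemiring = isCommutativeSemiringˡ record
    { +-isCommutativeMonoid = isCommutativeMonoidˡ record
      { isSemigroup = record
        { isMagma = record
          { isEquivalence = ≋-isEquivalence
          ; ∙-cong        = λ p≋p′ q≋q′ → coeffwise λ n → +-cong (coeff p≋p′ n) (coeff q≋q′ n) }
        ; assoc = λ p q r → coeffwise λ n → +-assoc _ _ _ }
      ; identityˡ = λ p → coeffwise λ n → +-identityˡ _
      ; comm      = λ p q → coeffwise λ n → +-comm _ _ }
    ; *-isCommutativeMonoid = isCommutativeMonoidˡ record
      { isSemigroup = record
        { isMagma = record { isEquivalence = ≋-isEquivalence ; ∙-cong = ⊠-cong }
        ; assoc   = ⊠-assoc }
      ; identityˡ = ⊠-identityˡ
      ; comm      = ⊠-comm }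
    ; distribʳ = λ r p q → ⊠-distribʳ p q r
    ; zeroˡ    = λ p → coeffwise λ n → ∑≤-zero n _ λ _ → zeroˡ _ }
    where
    ≋-isEquivalence : IsEquivalence _≋_
    ≋-isEquivalence = record
      { refl  = coeffwise λ _ → refl
      ; sym   = λ p≋q → coeffwise λ n → sym (coeff p≋q n)
      ; trans = λ p≋q q≋r → coeffwise λ n → trans (coeff p≋q n) (coeff q≋r n) }

  ⊞-⊠-commutativeSemiring : CommutativeSemiring c e
  ⊞-⊠-commutativeSemiring = record { isCommutativeSemiring = ⊞-⊠-isCommutativeSemiring }

module ℕ[[t]] = PowerSeries ℕₚ.+-*-commutativeSemiring
module ℕ[[t]][[x]] = PowerSeries ℕ[[t]].⊞-⊠-commutativeSemiring

open ℕ[[t]][[x]] using (_⊠_; 𝕩-⊠-zero; 𝕩-⊠-suc) renaming (_≋_ to _≈_)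

coeffwise₂ : ∀ {p q : Series} → (∀ i j → p i j ≡ q i j) → p ≈ q
coeffwise₂ p≡q = ℕ[[t]][[x]].coeffwise λ i → ℕ[[t]].coeffwise (p≡q i)

coeff₂ : ∀ {p q : Series} → p ≈ q → ∀ i j → p i j ≡ q i j
coeff₂ p≈q i = ℕ[[t]].coeff (ℕ[[t]][[x]].coeff p≈q i)

sumTo-cong : ∀ n {f g : ℕ → ℕ} → (∀ a → f a ≡ g a) → sumTo n f ≡ sumTo n g
sumTo-cong zero    f≡g = f≡g 0
sumTo-cong (suc n) f≡g = ≡.cong₂ ℕ._+_ (sumTo-cong n f≡g) (f≡g (suc n))

sumTo≡∑≤ : ∀ n f → sumTo n f ≡ ℕ[[t]].∑≤ n f
sumTo≡∑≤ zero    f = ≡.refl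
sumTo≡∑≤ (suc n) f = ≡.cong (ℕ._+ f (suc n)) (sumTo≡∑≤ n f)

∑≤-coeff : ∀ n (F : ℕ → ℕ[[t]].PowerSeries) j → ℕ[[t]][[x]].∑≤ n F j ≡ sumTo n (λ a → F a j)
∑≤-coeff zero    F j = ≡.refl
∑≤-coeff (suc n) F j = ≡.cong (ℕ._+ F (suc n) j) (∑≤-coeff n F j)

⊗≈⊠ : ∀ p q → p ⊗ q ≈ p ⊠ q
⊗≈⊠ p q = coeffwise₂ λ i j →
  ≡.sym (≡.trans (∑≤-coeff i _ j) (sumTo-cong i λ a → ≡.sym (sumTo≡∑≤ j _)))

cst-0 : ∀ i j → cst 0 i j ≡ 0
cst-0 zero    zero    = ≡.refl
cst-0 zero    (suc _) = ≡.refl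
cst-0 (suc _) _       = ≡.refl

series : CommutativeSemiring 0ℓ 0ℓ
series = record
  { Carrier = Series
  ; _≈_     = _≈_
  ; _+_     = _⊕_
  ; _*_     = _⊗_
  ; 0#      = cst 0
  ; 1#      = 𝟙
  ; isCommutativeSemiring = isCommutativeSemiring-subst ℕ[[t]][[x]].⊞-⊠-commutativeSemiring
      ⊗≈⊠ (coeffwise₂ cst-0) (coeffwise₂ 𝟙≡𝟏) }
  where
  𝟙≡𝟏 : ∀ i j → 𝟙 i j ≡ ℕ[[t]][[x]].𝟏 i j
  𝟙≡𝟏 zero    zero    = ≡.refl
  𝟙≡𝟏 zero    (suc _) = ≡.refl
  𝟙≡𝟏 (suc _) _       = ≡.refl

open CommutativeSemiring series
  using ( refl; sym; trans; reflexive; setoid; +-cong; *-cong; +-assoc; +-comm; +-identityˡ; +-identityʳ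
        ; *-comm; *-identityʳ; distribˡ; distribʳ; zeroˡ; zeroʳ)
open import Relation.Binary.Reasoning.Setoid setoid
open import Algebra.Solver.Ring.NaturalCoefficients.Default series
open import Algebra.Properties.Semiring.Exp (CommutativeSemiring.semiring series) using (_^_)
open import Algebra.Properties.CommutativeSemiring.Exp series using (^-distrib-*)
open import Algebra.Properties.Monoid.Sum (CommutativeSemiring.+-monoid series)
  using (sum-syntax; sum-cong-≋; sum-replicate-zero)

-- _⊕_ and _⊗_ unfold during unification, so the fixed operand is passed explicitly
⊕-congˡ : ∀ p {q q′} → q ≈ q′ → p ⊕ q ≈ p ⊕ q′
⊕-congˡ p = +-cong (refl {p})

⊕-congʳ : ∀ q {p p′} → p ≈ p′ → p ⊕ q ≈ p′ ⊕ q
⊕-congʳ q p≈p′ = +-cong p≈p′ (refl {q})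

⊗-congˡ : ∀ p {q q′} → q ≈ q′ → p ⊗ q ≈ p ⊗ q′
⊗-congˡ p = *-cong (refl {p})

⊗-congʳ : ∀ q {p p′} → p ≈ p′ → p ⊗ q ≈ p′ ⊗ q
⊗-congʳ q p≈p′ = *-cong p≈p′ (refl {q})

X⊗≈𝕩⊠ : ∀ p → X ⊗ p ≈ ℕ[[t]][[x]].𝕩 ⊠ p
X⊗≈𝕩⊠ p = trans (⊗≈⊠ X p) (ℕ[[t]][[x]].⊠-congʳ p (coeffwise₂ X≡𝕩))
  where
  X≡𝕩 : ∀ i j → X i j ≡ ℕ[[t]][[x]].𝕩 i j
  X≡𝕩 zero          _       = ≡.refl
  X≡𝕩 (suc zero)    zero    = ≡.refl
  X≡𝕩 (suc zero)    (suc _) = ≡.refl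
  X≡𝕩 (suc (suc _)) _       = ≡.refl

T⊗≈t· : ∀ p → T ⊗ p ≈ ℕ[[t]].𝕩 ℕ[[t]][[x]].· p
T⊗≈t· p = trans (⊗≈⊠ T p)
  (trans (ℕ[[t]][[x]].⊠-congʳ p (coeffwise₂ T≡t)) (ℕ[[t]][[x]].const-⊠ ℕ[[t]].𝕩 p))
  where
  T≡t : ∀ i j → T i j ≡ ℕ[[t]][[x]].const ℕ[[t]].𝕩 i j
  T≡t zero    zero          = ≡.refl
  T≡t zero    (suc zero)    = ≡.refl
  T≡t zero    (suc (suc _)) = ≡.refl
  T≡t (suc _) _             = ≡.refl

X⊗-zero : ∀ p j → (X ⊗ p) 0 j ≡ 0
X⊗-zero p j = ≡.trans (coeff₂ (X⊗≈𝕩⊠ p) 0 j) (ℕ[[t]].coeff (𝕩-⊠-zero p) j)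

X⊗-suc : ∀ p i j → (X ⊗ p) (suc i) j ≡ p i j
X⊗-suc p i j = ≡.trans (coeff₂ (X⊗≈𝕩⊠ p) (suc i) j) (ℕ[[t]].coeff (𝕩-⊠-suc p i) j)

T⊗-zero : ∀ p i → (T ⊗ p) i 0 ≡ 0
T⊗-zero p i = ≡.trans (coeff₂ (T⊗≈t· p) i 0) (ℕ[[t]].𝕩-⊠-zero (p i))

T⊗-suc : ∀ p i j → (T ⊗ p) i (suc j) ≡ p i j
T⊗-suc p i j = ≡.trans (coeff₂ (T⊗≈t· p) i (suc j)) (ℕ[[t]].𝕩-⊠-suc (p i) j)

∑-coeff : ∀ d (F : Fin d → Series) i j → (∑[ k < d ] F k) i j ≡ ℕΣ.sum (λ k → F k i j)
∑-coeff zero    F i j = cst-0 i j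
∑-coeff (suc d) F i j = ≡.cong (F Fin.zero i j ℕ.+_) (∑-coeff d (F ∘ Fin.suc) i j)

ΣS-cong : ∀ n {f g : ℕ → Series} → (∀ k → f (suc k) ≈ g (suc k)) → ΣS n f ≈ ΣS n g
ΣS-cong zero    f≈g = refl
ΣS-cong (suc n) f≈g = +-cong (ΣS-cong n f≈g) (f≈g n)

ΣS-suc-head : ∀ n f → ΣS (suc n) f ≈ f 1 ⊕ ΣS n (f ∘ suc)
ΣS-suc-head zero    f = +-comm (cst 0) (f 1)
ΣS-suc-head (suc n) f = trans (⊕-congʳ (f (suc (suc n))) (ΣS-suc-head n f)) (+-assoc (f 1) _ _)

ΣS-distrib-⊕ : ∀ n f g → ΣS n (λ k → f k ⊕ g k) ≈ ΣS n f ⊕ ΣS n g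
ΣS-distrib-⊕ zero    f g = sym (+-identityˡ (cst 0))
ΣS-distrib-⊕ (suc n) f g = begin
  ΣS n (λ k → f k ⊕ g k) ⊕ (f (suc n) ⊕ g (suc n))
    ≈⟨ ⊕-congʳ (f (suc n) ⊕ g (suc n)) (ΣS-distrib-⊕ n f g) ⟩
  ΣS n f ⊕ ΣS n g ⊕ (f (suc n) ⊕ g (suc n))
    ≈⟨ solve 4 (λ a b c d → (a :+ b) :+ (c :+ d) := (a :+ c) :+ (b :+ d)) refl
               (ΣS n f) (ΣS n g) (f (suc n)) (g (suc n)) ⟩
  ΣS n f ⊕ f (suc n) ⊕ (ΣS n g ⊕ g (suc n)) ∎

⊗-distribˡ-ΣS : ∀ n p f → p ⊗ ΣS n f ≈ ΣS n (λ k → p ⊗ f k)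
⊗-distribˡ-ΣS zero    p f = zeroʳ p
⊗-distribˡ-ΣS (suc n) p f =
  trans (distribˡ p (ΣS n f) (f (suc n))) (⊕-congʳ (p ⊗ f (suc n)) (⊗-distribˡ-ΣS n p f))

cst-+ : ∀ a b → cst (a ℕ.+ b) ≈ cst a ⊕ cst b
cst-+ a b = coeffwise₂ λ where
  zero    zero    → ≡.refl
  zero    (suc _) → ≡.refl
  (suc _) _       → ≡.refl

^^≡^ : ∀ p k → p ^^ k ≡ p ^ k
^^≡^ p zero    = ≡.refl
^^≡^ p (suc k) = ≡.cong (p ⊗_) (^^≡^ p k)

^^-distrib-⊗ : ∀ p q k → (p ⊗ q) ^^ k ≈ p ^^ k ⊗ q ^^ k
^^-distrib-⊗ p q k = begin
  (p ⊗ q) ^^ k    ≡⟨ ^^≡^ (p ⊗ q) k ⟩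
  (p ⊗ q) ^ k     ≈⟨ ^-distrib-* p q k ⟩
  p ^ k ⊗ q ^ k   ≡⟨ ≡.cong₂ _⊗_ (^^≡^ p k) (^^≡^ q k) ⟨
  p ^^ k ⊗ q ^^ k ∎

powerSum : ℕ → Series
powerSum ℓ = ΣS ℓ (λ m → X ^^ m)

powerSum-suc : ∀ r → powerSum (suc r) ≈ X ⊗ (𝟙 ⊕ powerSum r)
powerSum-suc zero    = solve 1 (λ x → con 0 :+ x :* con 1 := x :* (con 1 :+ con 0)) refl X
powerSum-suc (suc r) = begin
  powerSum (suc r) ⊕ X ⊗ X ^^ suc r
    ≈⟨ ⊕-congʳ (X ⊗ X ^^ suc r) (powerSum-suc r) ⟩
  X ⊗ (𝟙 ⊕ powerSum r) ⊕ X ⊗ X ^^ suc r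
    ≈⟨ solve 3 (λ x s p → x :* (con 1 :+ s) :+ x :* p := x :* (con 1 :+ (s :+ p))) refl X (powerSum r) (X ^^ suc r) ⟩
  X ⊗ (𝟙 ⊕ (powerSum r ⊕ X ^^ suc r)) ∎

binomialQuotient : Series → ℕ → Series
binomialQuotient Y e = ΣS e (λ k → cst (e C k) ⊗ Y ^^ (k ∸ 1))

binomialQuotient-suc : ∀ Y e →
  binomialQuotient Y (suc e) ≈ (𝟙 ⊕ Y ⊗ binomialQuotient Y e) ⊕ binomialQuotient Y e
binomialQuotient-suc Y e = begin
  binomialQuotient Y (suc e)
    ≈⟨ ΣS-cong (suc e) pascal ⟩
  ΣS (suc e) (λ k → lower k ⊕ same k)
    ≈⟨ ΣS-distrib-⊕ (suc e) lower same ⟩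
  ΣS (suc e) lower ⊕ ΣS (suc e) same
    ≈⟨ +-cong (ΣS-suc-head e lower) (⊕-congˡ G (⊗-congʳ (Y ^^ e) (reflexive (≡.cong cst eCsuce≡0)))) ⟩
  (𝟙 ⊗ 𝟙 ⊕ ΣS e (lower ∘ suc)) ⊕ (G ⊕ cst 0 ⊗ Y ^^ e)
    ≈⟨ +-cong (+-cong (*-identityʳ 𝟙) shifted) (trans (⊕-congˡ G (zeroˡ (Y ^^ e))) (+-identityʳ G)) ⟩
  (𝟙 ⊕ Y ⊗ G) ⊕ G ∎
  where
  G = binomialQuotient Y e
  eCsuce≡0 = k>n⇒nCk≡0 (ℕₚ.n<1+n e)
  lower same : ℕ → Series
  lower k = cst (e C (k ∸ 1)) ⊗ Y ^^ (k ∸ 1)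
  same  k = cst (e C k) ⊗ Y ^^ (k ∸ 1)
  pascal : ∀ k → cst (suc e C suc k) ⊗ Y ^^ k ≈ lower (suc k) ⊕ same (suc k)
  pascal k = begin
    cst (suc e C suc k) ⊗ Y ^^ k
      ≈⟨ ⊗-congʳ (Y ^^ k) (reflexive (≡.cong cst (≡.sym (nCk+nC[k+1]≡[n+1]C[k+1] e k)))) ⟩
    cst (e C k ℕ.+ e C suc k) ⊗ Y ^^ k
      ≈⟨ ⊗-congʳ (Y ^^ k) (cst-+ _ _) ⟩
    (cst (e C k) ⊕ cst (e C suc k)) ⊗ Y ^^ k
      ≈⟨ distribʳ (Y ^^ k) (cst (e C k)) (cst (e C suc k)) ⟩
    lower (suc k) ⊕ same (suc k) ∎
  shifted : ΣS e (lower ∘ suc) ≈ Y ⊗ G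
  shifted = begin
    ΣS e (lower ∘ suc)
      ≈⟨ ΣS-cong e (λ k → solve 3 (λ c y z → c :* (y :* z) := y :* (c :* z)) refl (cst (e C suc k)) Y (Y ^^ k)) ⟩
    ΣS e (λ k → Y ⊗ same k)
      ≈⟨ ⊗-distribˡ-ΣS e Y same ⟨
    Y ⊗ G ∎

binomial : ∀ Y e → (𝟙 ⊕ Y) ^^ e ≈ 𝟙 ⊕ Y ⊗ binomialQuotient Y e
binomial Y zero    = sym (trans (⊕-congˡ 𝟙 (zeroʳ Y)) (+-identityʳ 𝟙))
binomial Y (suc e) = begin
  (𝟙 ⊕ Y) ⊗ (𝟙 ⊕ Y) ^^ e
    ≈⟨ ⊗-congˡ (𝟙 ⊕ Y) (binomial Y e) ⟩
  (𝟙 ⊕ Y) ⊗ (𝟙 ⊕ Y ⊗ G)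
    ≈⟨ solve 2 (λ y g → (con 1 :+ y) :* (con 1 :+ y :* g) := con 1 :+ y :* ((con 1 :+ y :* g) :+ g)) refl Y G ⟩
  𝟙 ⊕ Y ⊗ ((𝟙 ⊕ Y ⊗ G) ⊕ G)
    ≈⟨ ⊕-congˡ 𝟙 (⊗-congˡ Y (binomialQuotient-suc Y e)) ⟨
  𝟙 ⊕ Y ⊗ binomialQuotient Y (suc e) ∎
  where G = binomialQuotient Y e

⊗-binomialQuotient : ∀ p t s d →
  p ⊗ t ⊗ binomialQuotient (t ⊗ s) d ≈ ΣS d (λ k → cst (d C k) ⊗ t ^^ k ⊗ p ⊗ s ^^ (k ∸ 1))
⊗-binomialQuotient p t s d = trans (⊗-distribˡ-ΣS d (p ⊗ t) _) (ΣS-cong d λ k → begin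
  p ⊗ t ⊗ (cst (d C suc k) ⊗ (t ⊗ s) ^^ k)
    ≈⟨ ⊗-congˡ (p ⊗ t) (⊗-congˡ (cst (d C suc k)) (^^-distrib-⊗ t s k)) ⟩
  p ⊗ t ⊗ (cst (d C suc k) ⊗ (t ^^ k ⊗ s ^^ k))
    ≈⟨ solve 5 (λ p t c tᵏ sᵏ → p :* t :* (c :* (tᵏ :* sᵏ)) := c :* (t :* tᵏ) :* p :* sᵏ)
               refl p t (cst (d C suc k)) (t ^^ k) (s ^^ k) ⟩
  cst (d C suc k) ⊗ t ^^ suc k ⊗ p ⊗ s ^^ k ∎)

tailSum : ℕ → ℕ → (ℕ → Series) → Series
tailSum d v K = ∑[ j < d ] (if v <ᵇ val j then K (val j) else cst 0)

tailSum-≥ : ∀ d v K → d ≤ v → tailSum d v K ≈ cst 0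
tailSum-≥ zero    v       K _         = refl
tailSum-≥ (suc d) (suc v) K (s≤s d≤v) =
  trans (⊕-congˡ (cst 0) (tailSum-≥ d v (K ∘ suc) d≤v)) (+-identityʳ (cst 0))

tailSum-< : ∀ d v K → v < d → tailSum d v K ≈ K (suc v) ⊕ tailSum d (suc v) K
tailSum-< (suc d) zero    K _         = ⊕-congˡ (K 1) (sym (+-identityˡ (tailSum d 0 (K ∘ suc))))
tailSum-< (suc d) (suc v) K (s≤s v<d) = begin
  cst 0 ⊕ tailSum d v (K ∘ suc)                           ≈⟨ +-identityˡ _ ⟩
  tailSum d v (K ∘ suc)                                   ≈⟨ tailSum-< d v (K ∘ suc) v<d ⟩
  K (suc (suc v)) ⊕ tailSum d (suc v) (K ∘ suc)           ≈⟨ ⊕-congˡ (K (suc (suc v))) (+-identityˡ _) ⟨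
  K (suc (suc v)) ⊕ (cst 0 ⊕ tailSum d (suc v) (K ∘ suc)) ∎

tailSum-system-solution : ∀ d a Y (K : ℕ → Series) → (∀ v → K v ≈ a ⊕ Y ⊗ tailSum d v K) →
  K 0 ≈ a ⊗ (𝟙 ⊕ Y) ^^ d × tailSum d 0 K ≈ a ⊗ binomialQuotient Y d
tailSum-system-solution d a Y K K-eq = downward d 0 (ℕₚ.+-identityʳ d)
  where
  G = binomialQuotient Y
  downward : ∀ e v → e ℕ.+ v ≡ d → K v ≈ a ⊗ (𝟙 ⊕ Y) ^^ e × tailSum d v K ≈ a ⊗ G e
  downward zero v ≡.refl = K-top , N-top
    where
    N-top : tailSum v v K ≈ a ⊗ cst 0
    N-top = trans (tailSum-≥ v v K ℕₚ.≤-refl) (sym (zeroʳ a))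
    K-top : K v ≈ a ⊗ 𝟙
    K-top = begin
      K v                   ≈⟨ K-eq v ⟩
      a ⊕ Y ⊗ tailSum v v K ≈⟨ ⊕-congˡ a (⊗-congˡ Y N-top) ⟩
      a ⊕ Y ⊗ (a ⊗ cst 0)   ≈⟨ solve 2 (λ a y → a :+ y :* (a :* con 0) := a :* con 1) refl a Y ⟩
      a ⊗ 𝟙                 ∎
  downward (suc e) v e+v≡d = K-v , N-v
    where
    v<d : v < d
    v<d = ≡.subst (suc v ≤_) e+v≡d (s≤s (ℕₚ.m≤n+m v e))
    above = downward e (suc v) (≡.trans (ℕₚ.+-suc e v) e+v≡d)
    N-v : tailSum d v K ≈ a ⊗ G (suc e)
    N-v = begin
      tailSum d v K                   ≈⟨ tailSum-< d v K v<d ⟩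
      K (suc v) ⊕ tailSum d (suc v) K ≈⟨ +-cong (proj₁ above) (proj₂ above) ⟩
      a ⊗ (𝟙 ⊕ Y) ^^ e ⊕ a ⊗ G e      ≈⟨ ⊕-congʳ (a ⊗ G e) (⊗-congˡ a (binomial Y e)) ⟩
      a ⊗ (𝟙 ⊕ Y ⊗ G e) ⊕ a ⊗ G e     ≈⟨ distribˡ a (𝟙 ⊕ Y ⊗ G e) (G e) ⟨
      a ⊗ ((𝟙 ⊕ Y ⊗ G e) ⊕ G e)       ≈⟨ ⊗-congˡ a (binomialQuotient-suc Y e) ⟨
      a ⊗ G (suc e)                   ∎
    K-v : K v ≈ a ⊗ (𝟙 ⊕ Y) ^^ suc e
    K-v = begin
      K v                     ≈⟨ K-eq v ⟩
      a ⊕ Y ⊗ tailSum d v K   ≈⟨ ⊕-congˡ a (⊗-congˡ Y N-v) ⟩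
      a ⊕ Y ⊗ (a ⊗ G (suc e)) ≈⟨ solve 3 (λ a y g → a :+ y :* (a :* g) := a :* (con 1 :+ y :* g))
                                          refl a Y (G (suc e)) ⟩
      a ⊗ (𝟙 ⊕ Y ⊗ G (suc e)) ≈⟨ ⊗-congˡ a (binomial Y (suc e)) ⟨
      a ⊗ (𝟙 ⊕ Y) ^^ suc e    ∎

module _ {A : Set} where

  count-≐ : ∀ {P Q : Pred A 0ℓ} (P? : Decidable P) (Q? : Decidable Q) → P ≐ Q →
    ∀ xs → count P? xs ≡ count Q? xs
  count-≐ P? Q? P≐Q xs = ≡.cong List.length (ListP.filter-≐ P? Q? P≐Q xs)

  count-++ : ∀ {P : Pred A 0ℓ} (P? : Decidable P) xs ys →
    count P? (xs List.++ ys) ≡ count P? xs ℕ.+ count P? ys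
  count-++ P? xs ys =
    ≡.trans (≡.cong List.length (ListP.filter-++ P? xs ys)) (ListP.length-++ (List.filter P? xs))

  count-none : ∀ {P : Pred A 0ℓ} (P? : Decidable P) → (∀ x → ¬ P x) → ∀ xs → count P? xs ≡ 0
  count-none P? ¬P xs = ≡.cong List.length (ListP.filter-none P? (All.universal ¬P xs))

module _ {A B : Set} where

  count-map : ∀ {P : Pred B 0ℓ} (P? : Decidable P) (f : A → B) xs →
    count P? (List.map f xs) ≡ count (P? ∘ f) xs
  count-map P? f []       = ≡.refl
  count-map P? f (x ∷ xs) with does (P? (f x))
  ... | true  = ≡.cong suc (count-map P? f xs)
  ... | false = count-map P? f xs

  count-concatMap-tabulate : ∀ {P : Pred B 0ℓ} (P? : Decidable P) (f : A → List B) d (g : Fin d → A) →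
    count P? (List.concatMap f (List.tabulate g)) ≡ ℕΣ.sum (λ j → count P? (f (g j)))
  count-concatMap-tabulate P? f zero    g = ≡.refl
  count-concatMap-tabulate P? f (suc d) g = ≡.trans (count-++ P? (f (g Fin.zero)) _)
    (≡.cong (count P? (f (g Fin.zero)) ℕ.+_) (count-concatMap-tabulate P? f d (g ∘ Fin.suc)))

count-words-suc : ∀ {D} {P : Pred (Word D) 0ℓ} (P? : Decidable P) n →
  count P? (words D (suc n))
    ≡ count (λ u → P? (nothing ∷ u)) (words D n)
      ℕ.+ ℕΣ.sum (λ j → count (λ u → P? (just j ∷ u)) (words D n))
count-words-suc {D} P? n = ≡.trans (count-++ P? (List.map (nothing ∷_) (words D n)) _) (≡.cong₂ ℕ._+_
  (count-map P? (nothing ∷_) (words D n))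
  (≡.trans (≡.cong (count P?) (ListP.concatMap-map extend just (List.allFin D)))
    (≡.trans (count-concatMap-tabulate P? (extend ∘ just) D id)
      (ℕΣ.sum-cong-≗ λ j → count-map P? (just j ∷_) (words D n)))))
  where
  extend : Letter D → List (Word D)
  extend a = List.map (a ∷_) (words D n)

gf : ∀ {D} → (Word D → Bool) → Series
gf {D} L n b = count (λ u → T? (L u) ×-dec (bigtiles u ≟ b)) (words D n)

gf-[] : ∀ {D} (L : Word D → Bool) b → gf L 0 b ≡ cst (if L [] then 1 else 0) 0 b
gf-[] L b with L []
gf-[] L zero    | true  = ≡.refl
gf-[] L (suc b) | true  = ≡.refl
gf-[] L zero    | false = ≡.refl
gf-[] L (suc b) | false = ≡.refl

gf-∷ : ∀ {D} (L : Word D → Bool) →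
  gf L ≈ cst (if L [] then 1 else 0)
       ⊕ X ⊗ (gf (λ u → L (nothing ∷ u)) ⊕ T ⊗ ∑[ j < D ] gf (λ u → L (just j ∷ u)))
gf-∷ {D} L = coeffwise₂ coeffs
  where
  Lⱼ : Fin D → Word D → Bool
  Lⱼ j u = L (just j ∷ u)
  justs rest : Series
  justs = ∑[ j < D ] gf (Lⱼ j)
  rest  = gf (λ u → L (nothing ∷ u)) ⊕ T ⊗ justs
  integerHeads : ∀ n b →
    ℕΣ.sum (λ j → count (λ u → T? (Lⱼ j u) ×-dec (suc (bigtiles u) ≟ b)) (words D n)) ≡ (T ⊗ justs) n b
  integerHeads n zero    = ≡.trans
    (ℕΣ.sum-cong-≗ {D} λ j →
      count-none (λ u → T? (Lⱼ j u) ×-dec (suc (bigtiles u) ≟ 0)) (λ _ ()) (words D n))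
    (≡.trans (ℕΣ.sum-replicate-zero D) (≡.sym (T⊗-zero justs n)))
  integerHeads n (suc b) = ≡.trans
    (ℕΣ.sum-cong-≗ λ j → count-≐ (λ u → T? (Lⱼ j u) ×-dec (suc (bigtiles u) ≟ suc b))
                                  (λ u → T? (Lⱼ j u) ×-dec (bigtiles u ≟ b))
                                  (Prod.map₂ ℕₚ.suc-injective , Prod.map₂ (≡.cong suc)) (words D n))
    (≡.sym (≡.trans (T⊗-suc justs n b) (∑-coeff D (gf ∘ Lⱼ) n b)))
  coeffs : ∀ i b → gf L i b ≡ (cst (if L [] then 1 else 0) ⊕ X ⊗ rest) i b
  coeffs zero    b = ≡.trans (gf-[] L b)
    (≡.sym (≡.trans (≡.cong (cst _ 0 b ℕ.+_) (X⊗-zero rest b)) (ℕₚ.+-identityʳ _)))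
  coeffs (suc n) b = ≡.trans (count-words-suc _ n)
    (≡.trans (≡.cong (gf (λ u → L (nothing ∷ u)) n b ℕ.+_) (integerHeads n b)) (≡.sym (X⊗-suc rest n b)))

gf-cong : ∀ {D} {L L′ : Word D → Bool} → (∀ u → L u ≡ L′ u) → gf L ≈ gf L′
gf-cong {D} L≗L′ = coeffwise₂ λ i b → count-≐ _ _
  (Prod.map₁ (≡.subst IsTrue (L≗L′ _)) , Prod.map₁ (≡.subst IsTrue (≡.sym (L≗L′ _)))) (words D i)

gf-false : ∀ {D} → gf {D} (λ _ → false) ≈ cst 0
gf-false {D} = coeffwise₂ λ i b → ≡.trans (count-none _ (λ _ → proj₁) (words D i)) (≡.sym (cst-0 i b))

gf-null : ∀ {D} → gf {D} List.null ≈ 𝟙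
gf-null {D} = begin
  gf List.null
    ≈⟨ gf-∷ List.null ⟩
  𝟙 ⊕ X ⊗ (gf (λ _ → false) ⊕ T ⊗ ∑[ j < D ] gf (λ _ → false))
    ≈⟨ ⊕-congˡ 𝟙 (⊗-congˡ X (+-cong gf-false (⊗-congˡ T ∑-false))) ⟩
  𝟙 ⊕ X ⊗ (cst 0 ⊕ T ⊗ cst 0)
    ≈⟨ solve 2 (λ x t → con 1 :+ x :* (con 0 :+ t :* con 0) := con 1) refl X T ⟩
  𝟙 ∎
  where
  ∑-false : ∑[ j < D ] gf {D} (λ _ → false) ≈ cst 0
  ∑-false = trans (sum-cong-≋ {D} λ _ → gf-false) (sum-replicate-zero D)

gf-∧ : ∀ {D} c (M : Word D → Bool) → gf (λ u → c ∧ M u) ≈ (if c then gf M else cst 0)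
gf-∧ true  M = refl
gf-∧ false M = gf-false

gf-∷-guarded : ∀ {D} (L : Word D → Bool) v (M : ℕ → Word D → Bool) →
  (∀ j u → L (just j ∷ u) ≡ ((v <ᵇ val j) ∧ M (val j) u)) →
  gf L ≈ cst (if L [] then 1 else 0) ⊕ X ⊗ (gf (λ u → L (nothing ∷ u)) ⊕ T ⊗ tailSum D v (gf ∘ M))
gf-∷-guarded {D} L v M L-just = trans (gf-∷ L) (⊕-congˡ (cst (if L [] then 1 else 0))
  (⊗-congˡ X (⊕-congˡ (gf (λ u → L (nothing ∷ u))) (⊗-congˡ T guarded))))
  where
  guarded : ∑[ j < D ] gf (λ u → L (just j ∷ u)) ≈ tailSum D v (gf ∘ M)
  guarded = sum-cong-≋ {D} λ j → trans (gf-cong (L-just j)) (gf-∧ (v <ᵇ val j) (M (val j)))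

module _ {ℓ d : ℕ} (μ : Shape ℓ) where

  Window : Letter d → Word d → Set
  Window a u = ∀ (k : Fin ℓ) → AnchorCond a (at u (toℕ k)) (lookup μ (Fin.suc k))

  isAnchor-[] : IsAnchor {d = d} μ []
  isAnchor-[] = (λ ()) , (λ ())

  isAnchor-∷ : ∀ a u → IsAnchor μ (a ∷ u) ⇔ (IsAnchor μ u × Window a u × (List.length u < ℓ → IsInf a))
  isAnchor-∷ a u = mk⇔
    (λ (cond , last) → ((cond ∘ Fin.suc) , (λ i → last (Fin.suc i) ∘ s≤s)) , cond Fin.zero , last Fin.zero)
    (λ ((cond , last) , window , lastₐ) →
      (λ { Fin.zero → window ; (Fin.suc i) → cond i }) ,
      (λ { Fin.zero → lastₐ ; (Fin.suc i) → last i ∘ s≤s⁻¹ }))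

  anchor-endsInBlock : ∀ {w : Word d} → IsAnchor μ w → ℓ ≤ List.length w →
    InfBlockAt ℓ w (List.length w ∸ ℓ)
  anchor-endsInBlock {w} (_ , last) ℓ≤n = ℕₚ.≤-reflexive (ℕₚ.m∸n+n≡m ℓ≤n) , λ j →
    ≡.subst (IsInf ∘ at w) (FinP.toℕ-fromℕ< (p<n j)) (last (Fin.fromℕ< (p<n j)) (n≤p+ℓ j))
    where
    n = List.length w
    p<n : ∀ (j : Fin ℓ) → n ∸ ℓ ℕ.+ toℕ j < n
    p<n j = ℕₚ.<-≤-trans (ℕₚ.+-monoʳ-< (n ∸ ℓ) (FinP.toℕ<n j))
                         (ℕₚ.≤-reflexive (ℕₚ.m∸n+n≡m ℓ≤n))
    n≤p+ℓ : ∀ (j : Fin ℓ) → n ≤ toℕ (Fin.fromℕ< (p<n j)) ℕ.+ ℓ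
    n≤p+ℓ j = ≡.subst (λ p → n ≤ p ℕ.+ ℓ) (≡.sym (FinP.toℕ-fromℕ< (p<n j)))
      (ℕₚ.≤-trans (ℕₚ.≤-reflexive (≡.sym (ℕₚ.m∸n+n≡m ℓ≤n)))
                  (ℕₚ.+-monoˡ-≤ ℓ (ℕₚ.m≤m+n (n ∸ ℓ) (toℕ j))))

module _ {D : ℕ} where

  infBlockAt-suc : ∀ k a (u : Word D) i → InfBlockAt k (a ∷ u) (suc i) ⇔ InfBlockAt k u i
  infBlockAt-suc k a u i = mk⇔ (Prod.map₁ s≤s⁻¹) (Prod.map₁ s≤s)

  infBlockAt-nothing∷ : ∀ k (u : Word D) → InfBlockAt (suc k) (nothing ∷ u) 0 ⇔ InfBlockAt k u 0
  infBlockAt-nothing∷ k u = mk⇔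
    (Prod.map s≤s⁻¹ (_∘ Fin.suc))
    (Prod.map s≤s λ inf → λ { Fin.zero → _ ; (Fin.suc j) → inf j })

  ¬infBlockAt-just∷ : ∀ k j (u : Word D) → ¬ InfBlockAt (suc k) (just j ∷ u) 0
  ¬infBlockAt-just∷ k j u (_ , inf) = inf Fin.zero

  infBlockAt-shrink : ∀ {k m} (u : Word D) → k ≤ m → InfBlockAt m u 0 → InfBlockAt k u 0
  infBlockAt-shrink u k≤m (m≤n , inf) = ℕₚ.≤-trans k≤m m≤n , λ j →
    ≡.subst (IsInf ∘ at u) (FinP.toℕ-inject≤ j k≤m) (inf (Fin.inject≤ j k≤m))

  NoEarlyBlock : ℕ → Word D → Set
  NoEarlyBlock ℓ w = ∀ (i : Fin (List.length w)) → InfBlockAt ℓ w (toℕ i) → toℕ i ℕ.+ ℓ ≡ List.length w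

  noEarlyBlock-∷ : ∀ ℓ a u →
    NoEarlyBlock ℓ (a ∷ u) ⇔ (NoEarlyBlock ℓ u × (InfBlockAt ℓ (a ∷ u) 0 → ℓ ≡ suc (List.length u)))
  noEarlyBlock-∷ ℓ a u = mk⇔
    (λ noBlock → (λ i → ℕₚ.suc-injective ∘ noBlock (Fin.suc i) ∘ from (infBlockAt-suc ℓ a u (toℕ i))) ,
                 noBlock Fin.zero)
    (λ (noBlock , noBlock₀) → λ
      { Fin.zero    → noBlock₀
      ; (Fin.suc i) → ≡.cong suc ∘ noBlock i ∘ to (infBlockAt-suc ℓ a u (toℕ i)) })

module Hook {D : ℕ} (h ℓ : ℕ) where

  μ : Shape ℓ
  μ = hook h ℓ

  Exceeds : ℕ → Letter D → Set
  Exceeds v nothing  = ⊤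
  Exceeds v (just b) = v < val b

  Above : ℕ → ℕ → Word D → Set
  Above v n u = ∀ (k : Fin n) → Exceeds v (at u (toℕ k))

  anchorCond-hook : ∀ j b k → AnchorCond (just j) b (lookup μ (Fin.suc k)) ⇔ Exceeds (val j) b
  anchorCond-hook j nothing  k = mk⇔ _ _
  anchorCond-hook j (just b) k = mk⇔ (≡.subst (_≤ val b) val+1≡) (≡.subst (_≤ val b) (≡.sym val+1≡))
    where
    val+1≡ : val j ℕ.+ lookup μ (Fin.suc k) ≡ suc (val j)
    val+1≡ = ≡.trans (≡.cong (val j ℕ.+_) (VecP.lookup-replicate k 1)) (ℕₚ.+-comm (val j) 1)

  isAnchor-nothing∷ : ∀ (u : Word D) → IsAnchor μ (nothing ∷ u) ⇔ IsAnchor μ u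
  isAnchor-nothing∷ u = mk⇔
    (proj₁ ∘ to (isAnchor-∷ μ nothing u))
    (λ anc → from (isAnchor-∷ μ nothing u) (anc , _ , _))

  isAnchor-just∷ : ∀ j u → IsAnchor μ (just j ∷ u) ⇔ (IsAnchor μ u × Above (val j) ℓ u × ℓ ≤ List.length u)
  isAnchor-just∷ j u = mk⇔
    (λ anc → let (ancᵤ , window , short) = to (isAnchor-∷ μ (just j) u) anc in
      ancᵤ , (λ k → to (anchorCond-hook j _ k) (window k)) , ℕₚ.≮⇒≥ short)
    (λ (ancᵤ , above , ℓ≤) → from (isAnchor-∷ μ (just j) u)
      (ancᵤ , (λ k → from (anchorCond-hook j _ k) (above k)) , (λ short → ℕₚ.<⇒≱ short ℓ≤)))

module AnchorWords₁ {D : ℕ} (h : ℕ) where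

  open Hook {D} h 1

  mutual
    anchor : Word D → Bool
    anchor []            = true
    anchor (nothing ∷ u) = anchor u
    anchor (just j ∷ u)  = follows (val j) u

    follows : ℕ → Word D → Bool
    follows v []            = false
    follows v (nothing ∷ u) = anchor u
    follows v (just j ∷ u)  = (v <ᵇ val j) ∧ follows (val j) u

  mutual
    anchor⇔IsAnchor : ∀ u → IsTrue (anchor u) ⇔ IsAnchor μ u
    anchor⇔IsAnchor []            = mk⇔ (λ _ → isAnchor-[] {d = D} μ) (λ _ → _)
    anchor⇔IsAnchor (nothing ∷ u) = ⇔.trans (anchor⇔IsAnchor u) (⇔.sym (isAnchor-nothing∷ u))
    anchor⇔IsAnchor (just j ∷ u)  = follows⇔IsAnchor-just∷ j u

    follows⇔IsAnchor-just∷ : ∀ j u → IsTrue (follows (val j) u) ⇔ IsAnchor μ (just j ∷ u)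
    follows⇔IsAnchor-just∷ j [] = mk⇔ (λ ())
      (λ anc → contradiction (proj₂ (proj₂ (to (isAnchor-just∷ j []) anc))) λ ())
    follows⇔IsAnchor-just∷ j (nothing ∷ u) = mk⇔
      (λ accepted → from (isAnchor-just∷ j _)
        (from (isAnchor-nothing∷ u) (to (anchor⇔IsAnchor u) accepted) , (λ { Fin.zero → _ }) , s≤s z≤n))
      (λ anc → from (anchor⇔IsAnchor u) (to (isAnchor-nothing∷ u) (proj₁ (to (isAnchor-just∷ j _) anc))))
    follows⇔IsAnchor-just∷ j (just j′ ∷ u) = mk⇔
      (λ accepted → let (increasing , rest) = to BoolP.T-∧ accepted in from (isAnchor-just∷ j _)
        ( to (follows⇔IsAnchor-just∷ j′ u) rest
        , (λ { Fin.zero → ℕₚ.<ᵇ⇒< (val j) (val j′) increasing })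
        , s≤s z≤n))
      (λ anc → let (anc′ , above , _) = to (isAnchor-just∷ j _) anc in
        from BoolP.T-∧ (ℕₚ.<⇒<ᵇ (above Fin.zero) , from (follows⇔IsAnchor-just∷ j′ u) anc′))

  A : Series
  A = gf anchor

  E : ℕ → Series
  E v = gf (follows v)

  F≈A : F μ D ≈ A
  F≈A = coeffwise₂ λ n b → count-≐ _ _
    ( (λ {w} → Prod.map₁ (from (anchor⇔IsAnchor w)))
    , (λ {w} → Prod.map₁ (to (anchor⇔IsAnchor w))))
    (words D n)

  E-eq : ∀ v → E v ≈ X ⊗ A ⊕ (X ⊗ T) ⊗ tailSum D v E
  E-eq v = trans (gf-∷-guarded (follows v) v follows (λ _ _ → ≡.refl))
    (solve 4 (λ x t a n → con 0 :+ x :* (a :+ t :* n) := x :* a :+ (x :* t) :* n) refl X T A (tailSum D v E))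

  A≈1+E₀ : A ≈ 𝟙 ⊕ E 0
  A≈1+E₀ = trans (gf-∷-guarded anchor 0 follows (λ _ _ → ≡.refl))
    (⊕-congˡ 𝟙 (trans (sym (+-identityˡ _)) (sym (gf-∷-guarded (follows 0) 0 follows (λ _ _ → ≡.refl)))))

  F-hook₁ : F μ D ≈ 𝟙 ⊕ F μ D ⊗ X ⊗ (𝟙 ⊕ X ⊗ T) ^^ D
  F-hook₁ = begin
    F μ D
      ≈⟨ F≈A ⟩
    A
      ≈⟨ A≈1+E₀ ⟩
    𝟙 ⊕ E 0
      ≈⟨ ⊕-congˡ 𝟙 (proj₁ (tailSum-system-solution D (X ⊗ A) (X ⊗ T) E E-eq)) ⟩
    𝟙 ⊕ X ⊗ A ⊗ (𝟙 ⊕ X ⊗ T) ^^ D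
      ≈⟨ ⊕-congˡ 𝟙 (⊗-congʳ ((𝟙 ⊕ X ⊗ T) ^^ D) (trans (*-comm X A) (⊗-congʳ X (sym F≈A)))) ⟩
    𝟙 ⊕ F μ D ⊗ X ⊗ (𝟙 ⊕ X ⊗ T) ^^ D ∎

module FaultFreeWords {D : ℕ} (h ℓ′ : ℕ) where

  ℓ : ℕ
  ℓ = suc ℓ′

  open Hook {D} h ℓ

  -- after v r u: u may follow, in a fault-free word, an integer of value v and then ℓ′ ∸ r letters ∞
  after : ℕ → ℕ → Word D → Bool
  after v r       []            = false
  after v r       (just j ∷ u)  = (v <ᵇ val j) ∧ after (val j) ℓ′ u
  after v zero    (nothing ∷ u) = List.null u
  after v (suc r) (nothing ∷ u) = after v r u

  After : ℕ → ℕ → Word D → Set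
  After v r u = IsAnchor μ u × NoEarlyBlock ℓ u × Above v (suc r) u × suc r ≤ List.length u
              × (InfBlockAt (suc r) u 0 → List.length u ≡ suc r)

  Exceeds-weaken : ∀ {v w} x → w ≤ v → Exceeds v x → Exceeds w x
  Exceeds-weaken nothing  _   _   = _
  Exceeds-weaken (just b) w≤v v<b = ℕₚ.≤-<-trans w≤v v<b

  Above-weaken : ∀ {v w m n} u → w ≤ v → n ≤ m → Above v m u → Above w n u
  Above-weaken {v} u w≤v n≤m above k = Exceeds-weaken (at u (toℕ k)) w≤v
    (≡.subst (Exceeds v ∘ at u) (FinP.toℕ-inject≤ k n≤m) (above (Fin.inject≤ k n≤m)))

  noEarlyBlock-start : ∀ (u : Word D) → NoEarlyBlock ℓ u → InfBlockAt ℓ u 0 → List.length u ≡ ℓ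
  noEarlyBlock-start []      _       (() , _)
  noEarlyBlock-start (_ ∷ _) noBlock block = ≡.sym (noBlock Fin.zero block)

  After-just : ∀ j u → After (val j) ℓ′ u ⇔ (IsAnchor μ (just j ∷ u) × NoEarlyBlock ℓ u)
  After-just j u = mk⇔
    (λ (anc , noBlock , above , ℓ≤ , _) → from (isAnchor-just∷ j u) (anc , above , ℓ≤) , noBlock)
    (λ (ancⱼ , noBlock) → let (anc , above , ℓ≤) = to (isAnchor-just∷ j u) ancⱼ in
      anc , noBlock , above , ℓ≤ , noEarlyBlock-start u noBlock)

  after⇔After : ∀ v r u → r ≤ ℓ′ → IsTrue (after v r u) ⇔ After v r u
  after⇔After v r [] _ = mk⇔ (λ ()) (λ { (_ , _ , _ , () , _) })
  after⇔After v r (just j ∷ u) r≤ℓ′ = mk⇔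
    (λ accepted →
      let (v<j , rest)     = to BoolP.T-∧ accepted
          (ancⱼ , noBlock) = to (After-just j u) (to (after⇔After (val j) ℓ′ u ℕₚ.≤-refl) rest)
          (_ , above , ℓ≤) = to (isAnchor-just∷ j u) ancⱼ
          v<val            = ℕₚ.<ᵇ⇒< v (val j) v<j
          r≤ℓ              = ℕₚ.m≤n⇒m≤1+n r≤ℓ′ in
      ancⱼ ,
      from (noEarlyBlock-∷ ℓ _ u) (noBlock , noBlockAtInteger) ,
      (λ { Fin.zero → v<val ; (Fin.suc k) → Above-weaken u (ℕₚ.<⇒≤ v<val) r≤ℓ above k }) ,
      s≤s (ℕₚ.≤-trans r≤ℓ ℓ≤) ,
      noBlockAtInteger)
    (λ (ancⱼ , noBlock , above , _ , _) → from BoolP.T-∧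
      ( ℕₚ.<⇒<ᵇ (above Fin.zero)
      , from (after⇔After (val j) ℓ′ u ℕₚ.≤-refl)
             (from (After-just j u) (ancⱼ , proj₁ (to (noEarlyBlock-∷ ℓ _ u) noBlock)))))
    where
    noBlockAtInteger : ∀ {A : Set} {k} → InfBlockAt (suc k) (just j ∷ u) 0 → A
    noBlockAtInteger block = ⊥-elim (¬infBlockAt-just∷ _ j u block)
  after⇔After v zero (nothing ∷ []) _ = mk⇔
    (λ _ → from (isAnchor-nothing∷ []) (isAnchor-[] {d = D} μ) ,
           (λ { Fin.zero (s≤s z≤n , _) → ≡.refl }) ,
           (λ { Fin.zero → _ }) ,
           s≤s z≤n ,
           (λ _ → ≡.refl))
    _
  after⇔After v zero (nothing ∷ _ ∷ u) _ = mk⇔ (λ ())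
    (λ (_ , _ , _ , _ , single) → contradiction (single (from (infBlockAt-nothing∷ 0 (_ ∷ u)) (z≤n , λ ()))) λ ())
  after⇔After v (suc r) (nothing ∷ u) r<ℓ′ = mk⇔
    (λ accepted → let (anc , noBlock , above , len , short) = to rest accepted in
      from (isAnchor-nothing∷ u) anc ,
      from (noEarlyBlock-∷ ℓ nothing u) (noBlock , λ block →
        let block′ = to (infBlockAt-nothing∷ ℓ′ u) block in
        ≡.cong suc (ℕₚ.≤-antisym (proj₁ block′)
          (≡.subst (_≤ ℓ′) (≡.sym (short (infBlockAt-shrink u r<ℓ′ block′))) r<ℓ′))) ,
      (λ { Fin.zero → _ ; (Fin.suc k) → above k }) ,
      s≤s len ,
      ≡.cong suc ∘ short ∘ to (infBlockAt-nothing∷ (suc r) u))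
    (λ (anc , noBlock , above , len , short) → from rest
      ( to (isAnchor-nothing∷ u) anc
      , proj₁ (to (noEarlyBlock-∷ ℓ nothing u) noBlock)
      , above ∘ Fin.suc
      , s≤s⁻¹ len
      , ℕₚ.suc-injective ∘ short ∘ from (infBlockAt-nothing∷ (suc r) u)))
    where
    rest = after⇔After v r u (ℕₚ.<⇒≤ r<ℓ′)

  after₀₀⇔IsFaultFree : ∀ w → IsTrue (after 0 0 w) ⇔ IsFaultFree μ w
  after₀₀⇔IsFaultFree [] = mk⇔ (λ ()) (λ { (_ , inj₁ ()) ; (_ , inj₂ (() , _)) })
  after₀₀⇔IsFaultFree (nothing ∷ []) =
    mk⇔ (λ _ → from (isAnchor-nothing∷ []) (isAnchor-[] {d = D} μ) , inj₁ ≡.refl) _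
  after₀₀⇔IsFaultFree (nothing ∷ _ ∷ _) = mk⇔ (λ ()) (λ { (_ , inj₁ ()) ; (_ , inj₂ (() , _)) })
  after₀₀⇔IsFaultFree (just j ∷ u) = mk⇔
    (λ accepted →
      let (ancⱼ , noBlock) = to (After-just j u) (to (after⇔After (val j) ℓ′ u ℕₚ.≤-refl) accepted)
          (_ , _ , ℓ≤)     = to (isAnchor-just∷ j u) ancⱼ in
      ancⱼ , inj₂ ( _
                  , (s≤s ℓ≤ , anchor-endsInBlock μ ancⱼ (ℕₚ.m≤n⇒m≤1+n ℓ≤))
                  , from (noEarlyBlock-∷ ℓ _ u) (noBlock , ⊥-elim ∘ ¬infBlockAt-just∷ ℓ′ j u)))
    (λ { (_ , inj₁ ()) ; (ancⱼ , inj₂ (_ , _ , noBlock)) →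
      from (after⇔After (val j) ℓ′ u ℕₚ.≤-refl)
           (from (After-just j u) (ancⱼ , proj₁ (to (noEarlyBlock-∷ ℓ _ u) noBlock))) })

  K : ℕ → Series
  K v = gf (after v ℓ′)

  gf-after : ∀ v r → gf (after v r) ≈ X ^^ suc r ⊕ T ⊗ powerSum (suc r) ⊗ tailSum D v K
  gf-after v r = trans (gf-∷-guarded (after v r) v (λ m → after m ℓ′) (λ _ _ → ≡.refl))
    (trans (+-identityˡ _) (extend r (prefix r)))
    where
    N = tailSum D v K
    prefix : ∀ r → gf (λ u → after v r (nothing ∷ u)) ≈ X ^^ r ⊕ T ⊗ powerSum r ⊗ N
    prefix zero    = trans gf-null (solve 2 (λ t n → con 1 := con 1 :+ t :* con 0 :* n) refl T N)
    prefix (suc r) = gf-after v r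
    extend : ∀ r {Q} → Q ≈ X ^^ r ⊕ T ⊗ powerSum r ⊗ N →
      X ⊗ (Q ⊕ T ⊗ N) ≈ X ^^ suc r ⊕ T ⊗ powerSum (suc r) ⊗ N
    extend r {Q} Q≈ = begin
      X ⊗ (Q ⊕ T ⊗ N)
        ≈⟨ ⊗-congˡ X (⊕-congʳ (T ⊗ N) Q≈) ⟩
      X ⊗ (X ^^ r ⊕ T ⊗ powerSum r ⊗ N ⊕ T ⊗ N)
        ≈⟨ solve 5 (λ x xʳ t s n → x :* (xʳ :+ t :* s :* n :+ t :* n) := x :* xʳ :+ t :* (x :* (con 1 :+ s)) :* n)
                   refl X (X ^^ r) T (powerSum r) N ⟩
      X ^^ suc r ⊕ T ⊗ (X ⊗ (𝟙 ⊕ powerSum r)) ⊗ N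
        ≈⟨ ⊕-congˡ (X ^^ suc r) (⊗-congʳ N (⊗-congˡ T (powerSum-suc r))) ⟨
      X ^^ suc r ⊕ T ⊗ powerSum (suc r) ⊗ N ∎

  B≈gf-after₀₀ : B μ D ≈ gf (after 0 0)
  B≈gf-after₀₀ = coeffwise₂ λ n b → count-≐ _ _
    ( (λ {w} → Prod.map₁ (from (after₀₀⇔IsFaultFree w)))
    , (λ {w} → Prod.map₁ (to (after₀₀⇔IsFaultFree w))))
    (words D n)

  B-hook : B μ D ≈ X ⊕ X ^^ suc ℓ ⊗ T ⊗ binomialQuotient (T ⊗ powerSum ℓ) D
  B-hook = begin
    B μ D
      ≈⟨ B≈gf-after₀₀ ⟩
    gf (after 0 0)
      ≈⟨ gf-after 0 0 ⟩
    X ^^ 1 ⊕ T ⊗ powerSum 1 ⊗ tailSum D 0 K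
      ≈⟨ ⊕-congˡ (X ^^ 1) (*-cong (⊗-congˡ T (powerSum-suc 0)) N₀) ⟩
    X ^^ 1 ⊕ T ⊗ (X ⊗ (𝟙 ⊕ cst 0)) ⊗ (X ^^ ℓ ⊗ G)
      ≈⟨ solve 4 (λ x t xˡ g → x :* con 1 :+ t :* (x :* (con 1 :+ con 0)) :* (xˡ :* g) := x :+ x :* xˡ :* t :* g)
                 refl X T (X ^^ ℓ) G ⟩
    X ⊕ X ^^ suc ℓ ⊗ T ⊗ G ∎
    where
    G = binomialQuotient (T ⊗ powerSum ℓ) D
    N₀ = proj₂ (tailSum-system-solution D (X ^^ ℓ) (T ⊗ powerSum ℓ) K (λ v → gf-after v ℓ′))

  B-hook-identity :
    B μ D ⊗ powerSum ℓ ⊕ X ^^ suc ℓ ≈ X ⊗ powerSum ℓ ⊕ X ^^ suc ℓ ⊗ (𝟙 ⊕ T ⊗ powerSum ℓ) ^^ D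
  B-hook-identity = begin
    B μ D ⊗ S ⊕ X ^^ suc ℓ
      ≈⟨ ⊕-congʳ (X ^^ suc ℓ) (⊗-congʳ S B-hook) ⟩
    (X ⊕ X ^^ suc ℓ ⊗ T ⊗ G) ⊗ S ⊕ X ^^ suc ℓ
      ≈⟨ solve 5 (λ x xˡ t g s → (x :+ xˡ :* t :* g) :* s :+ xˡ := x :* s :+ xˡ :* (con 1 :+ t :* s :* g))
                 refl X (X ^^ suc ℓ) T G S ⟩
    X ⊗ S ⊕ X ^^ suc ℓ ⊗ (𝟙 ⊕ T ⊗ S ⊗ G)
      ≈⟨ ⊕-congˡ (X ⊗ S) (⊗-congˡ (X ^^ suc ℓ) (binomial (T ⊗ S) D)) ⟨
    X ⊗ S ⊕ X ^^ suc ℓ ⊗ (𝟙 ⊕ T ⊗ S) ^^ D ∎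
    where
    S = powerSum ℓ
    G = binomialQuotient (T ⊗ S) D

  B-hook-expansion : B μ D ≈ X ⊕ ΣS D (λ k → cst (D C k) ⊗ T ^^ k ⊗ X ^^ suc ℓ ⊗ powerSum ℓ ^^ (k ∸ 1))
  B-hook-expansion = trans B-hook (⊕-congˡ X (⊗-binomialQuotient (X ^^ suc ℓ) T (powerSum ℓ) D))

theorem4p16 :
    ( ∀ (ℓ h d : ℕ) → 1 ≤ ℓ → 1 ≤ h → 1 ≤ d → d ≤ h →
        -- B · S + x^{ℓ+1} = x · S + x^{ℓ+1} (1 + t S)^d,  S = x + ⋯ + x^ℓ
        (∀ i j → (B (hook h ℓ) d ⊗ ΣS ℓ (λ m → X ^^ m) ⊕ X ^^ suc ℓ) i j
                 ≡ (X ⊗ ΣS ℓ (λ m → X ^^ m)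
                    ⊕ X ^^ suc ℓ ⊗ (𝟙 ⊕ T ⊗ ΣS ℓ (λ m → X ^^ m)) ^^ d) i j)
      × (∀ i j → B (hook h ℓ) d i j
                 ≡ (X ⊕ ΣS d (λ k → cst (d C k) ⊗ T ^^ k ⊗ X ^^ suc ℓ
                                     ⊗ ΣS ℓ (λ m → X ^^ m) ^^ (k ∸ 1))) i j))
    × ( ∀ (h : ℕ) → 1 ≤ h →
        -- F = 1 / (1 - x (1 + x t)^h), i.e. F = 1 + F · x (1 + x t)^h
        ∀ i j → F (hook h 1) h i j ≡ (𝟙 ⊕ F (hook h 1) h ⊗ X ⊗ (𝟙 ⊕ X ⊗ T) ^^ h) i j)
-- μ₀ = h never enters the anchor condition.
theorem4p16 =
  (λ { zero     _ _ () _ _ _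
     ; (suc ℓ′) h d _ _ _ _ → coeff₂ (FaultFreeWords.B-hook-identity {d} h ℓ′)
                            , coeff₂ (FaultFreeWords.B-hook-expansion {d} h ℓ′) }) ,
  (λ h _ → coeff₂ (AnchorWords₁.F-hook₁ {h} h))
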